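{- Let $\mathbf A$ be an integral FL${}_{\mathrm e}$-algebra. The following are equivalent: (1) $\mathbf A\in\mathbf G_{\mathsf{FL}_{\mathsf{ei}}}(\mathsf{BA})$, i.e. $\mathbf A$ is strongly pseudo-complemented: $\neg x\wedge\neg(x\to y)\leq 0$ for all $x,y\in A$; (2) for every binary operation ${\Rightarrow}$ on $A$ with $(x\to y)\cdot(y\to\neg\neg x)\leq x{\Rightarrow} y\leq (x\to y)\wedge(y\to\neg\neg x)$ for all $x,y$, $(\mathbf A,{\Rightarrow})$ is proto-connexive; (3) there exist an increasing map $\delta\colon A\to A$ (i.e. $x\leq\delta(x)$ for all $x$) and a binary operation ${\Rightarrow}$ on $A$ with $(x\to y)\cdot(y\to\delta(x))\leq x{\Rightarrow} y\leq (x\to y)\wedge(y\to\delta(x))$ for all $x,y$, such that $1\leq (x{\Rightarrow} y){\Rightarrow}\neg(x{\Rightarrow}\neg y)$ for all $x,y\in A$.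
   Context: An FL${}_{\mathrm e}$-algebra is an algebra $\langle A,\wedge,\vee,\cdot,\to,0,1\rangle$ such that $\langle A,\wedge,\vee\rangle$ is a lattice (with order $\leq$), $\langle A,\cdot,1\rangle$ is a commutative monoid, $0$ is an arbitrary constant, and $x\cdot y\leq z\iff x\leq y\to z$; it is integral if $1$ is the greatest element. Write $\neg x:=x\to 0$. $(\mathbf A,{\Rightarrow})$ is proto-connexive if for all $x,y\in A$: $1\leq\neg(x{\Rightarrow}\neg x)$, $1\leq\neg(\neg x{\Rightarrow} x)$, $1\leq (x{\Rightarrow} y){\Rightarrow}\neg(x{\Rightarrow}\neg y)$, $1\leq (x{\Rightarrow}\neg y){\Rightarrow}\neg(x{\Rightarrow} y)$. $\mathsf{BA}$ is the variety of Boolean algebras viewed as FL${}_{\mathrm e}$-algebras satisfying $x\cdot y=x\wedge y$ and $x\to y=\neg x\vee y$; $\mathbf G_{\mathsf{FL}_{\mathsf e}}(\mathsf{BA})$ is the largest variety $\mathsf W$ of FL${}_{\mathrm e}$-algebras such that for every equation $s\approx t$, $\mathsf{BA}\models s\approx t$ iff $\mathsf W\models\neg s\approx\neg t$, and $\mathbf G_{\mathsf{FL}_{\mathsf{ei}}}(\mathsf{BA})$ is its intersection with the variety of integral FL${}_{\mathrm e}$-algebras. -}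

module Defs where

open import Level using (Level; suc; _⊔_)
open import Relation.Binary.PropositionalEquality using (_≡_)
open import Data.Product using (_×_; Σ; ∃)
open import Function.Bundles using (_⇔_)

-- An FLe-algebra ⟨A, ∧, ∨, ·, →, 0, 1⟩ (carrier with propositional equality).
-- Lattice given by the usual lattice equations; order x ≤ y :⇔ x ∧ y ≡ x.
record FLeAlgebra (a : Level) : Set (suc a) where
  infixr 6 _∧_ _∨_
  infixl 7 _·_
  infixr 5 _⇒_
  infix 4 _≤_
  field
    Carrier : Set a
    _∧_ _∨_ _·_ _⇒_ : Carrier → Carrier → Carrier
    𝟘 𝟙 : Carrier
    ∧-comm : ∀ x y → x ∧ y ≡ y ∧ x
    ∨-comm : ∀ x y → x ∨ y ≡ y ∨ x
    ∧-assoc : ∀ x y z → (x ∧ y) ∧ z ≡ x ∧ (y ∧ z)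
    ∨-assoc : ∀ x y z → (x ∨ y) ∨ z ≡ x ∨ (y ∨ z)
    ∧-absorbs-∨ : ∀ x y → x ∧ (x ∨ y) ≡ x
    ∨-absorbs-∧ : ∀ x y → x ∨ (x ∧ y) ≡ x
    ·-comm : ∀ x y → x · y ≡ y · x
    ·-assoc : ∀ x y z → (x · y) · z ≡ x · (y · z)
    ·-identityˡ : ∀ x → 𝟙 · x ≡ x

  _≤_ : Carrier → Carrier → Set a
  x ≤ y = x ∧ y ≡ x

  field
    residuation : ∀ x y z → (x · y ≤ z) ⇔ (x ≤ (y ⇒ z))

  ¬_ : Carrier → Carrier
  ¬ x = x ⇒ 𝟘


Integral : ∀ {a} → FLeAlgebra a → Set a
Integral A = ∀ x → FLeAlgebra._≤_ A x (FLeAlgebra.𝟙 A)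

module _ {a} (A : FLeAlgebra a) where
  open FLeAlgebra A renaming (_⇒_ to _↝_)

  StronglyPseudoComplemented : Set a
  StronglyPseudoComplemented = ∀ x y → (¬ x) ∧ (¬ (x ↝ y)) ≤ 𝟘

  ProtoConnexive : (Carrier → Carrier → Carrier) → Set a
  ProtoConnexive _⇛_ =
      (∀ x → 𝟙 ≤ ¬ (x ⇛ (¬ x)))
    × (∀ x → 𝟙 ≤ ¬ ((¬ x) ⇛ x))
    × (∀ x y → 𝟙 ≤ ((x ⇛ y) ⇛ (¬ (x ⇛ (¬ y)))))
    × (∀ x y → 𝟙 ≤ ((x ⇛ (¬ y)) ⇛ (¬ (x ⇛ y))))

  Bounded : (Carrier → Carrier) → (Carrier → Carrier → Carrier) → Set a
  Bounded δ _⇛_ = ∀ x y →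
      ((x ↝ y) · (y ↝ δ x) ≤ (x ⇛ y))
    × ((x ⇛ y) ≤ ((x ↝ y) ∧ (y ↝ δ x)))

  Cond1 : Set a
  Cond1 = StronglyPseudoComplemented

  Cond2 : Set a
  Cond2 = (_⇛_ : Carrier → Carrier → Carrier) →
          Bounded (λ x → ¬ (¬ x)) _⇛_ → ProtoConnexive _⇛_

  Cond3 : Set a
  Cond3 = Σ (Carrier → Carrier) λ δ → Σ (Carrier → Carrier → Carrier) λ _⇛_ →
          (∀ x → x ≤ δ x) × Bounded δ _⇛_ ×
          (∀ x y → 𝟙 ≤ ((x ⇛ y) ⇛ (¬ (x ⇛ (¬ y)))))

{-# OPTIONS --safe #-}
module Submission where

open import Defs
open import Level using (Level)
open import Data.Product using (_×_; _,_; proj₁; proj₂)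
open import Function.Base using (_∘_)
open import Function.Bundles using (_⇔_; mk⇔; Equivalence)
open import Relation.Binary.PropositionalEquality
  using (_≡_; refl; sym; trans; cong; cong₂; isEquivalence; module ≡-Reasoning)
open import Relation.Binary.Bundles using (Poset)
open import Algebra.Bundles using (CommutativeSemigroup)
import Algebra.Properties.CommutativeSemigroup as CommutativeSemigroupProperties
import Relation.Binary.Reasoning.PartialOrder as PosetReasoning

-- Strong pseudo-complementation gives x ↝ ¬ x ≤ ¬ x and ¬ x ∧ ¬ ¬ x ≤ 𝟘, so an
-- element w with w · t ≤ ¬ t and w · ¬ t ≤ ¬ ¬ t lies below 𝟘: a case split on t
-- versus ¬ t.  For (1 ⇒ 2), the bounds on x ⇛ y and x ⇛ ¬ y (and on their negations)
-- send each case to complementary elements, so both products (x ⇛ y) · (x ⇛ ¬ y) and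
-- ¬ (x ⇛ y) · ¬ (x ⇛ ¬ y) are 𝟘, and the lower bound on ⇛ turns this into the
-- connexive laws.  For (2 ⇒ 3) take δ = ¬ ¬ and x ⇛ y = (x ↝ y) ∧ (y ↝ ¬ ¬ x).
-- For (3 ⇒ 1), the one connexive law forces δ = ¬ ¬ (instances x = 𝟙 and y = 𝟙) and
-- x ↝ ¬ x ≤ ¬ x, so x · x ≤ 𝟘 implies x ≤ 𝟘; and m = ¬ x ∧ ¬ (x ↝ y) satisfies
-- m · m ≤ ¬ (x ⇛ y) · ¬ (x ⇛ ¬ y) ≤ 𝟘.

module IntegralFLe {a} (A : FLeAlgebra a) (integral : Integral A) where
  open FLeAlgebra A renaming (_⇒_ to _↝_)

  private variable p q t u v w x y z : Carrier

  ∧-idem : ∀ x → x ∧ x ≡ x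
  ∧-idem x = trans (cong (x ∧_) (sym (∨-absorbs-∧ x x))) (∧-absorbs-∨ x (x ∧ x))

  ≤-trans : x ≤ y → y ≤ z → x ≤ z
  ≤-trans {x} {y} {z} x≤y y≤z = begin
    x ∧ z       ≡⟨ cong (_∧ z) (sym x≤y) ⟩
    (x ∧ y) ∧ z ≡⟨ ∧-assoc x y z ⟩
    x ∧ (y ∧ z) ≡⟨ cong (x ∧_) y≤z ⟩
    x ∧ y       ≡⟨ x≤y ⟩
    x           ∎
    where open ≡-Reasoning

  ≤-poset : Poset a a a
  ≤-poset = record
    { _≈_ = _≡_
    ; _≤_ = _≤_
    ; isPartialOrder = record
      { isPreorder = record
        { isEquivalence = isEquivalence
        ; reflexive = λ { refl → ∧-idem _ }
        ; trans = ≤-trans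
        }
      ; antisym = λ {x} {y} x≤y y≤x → trans (sym x≤y) (trans (∧-comm x y) y≤x)
      }
    }

  open Poset ≤-poset using () renaming (refl to ≤-refl; reflexive to ≤-reflexive; antisym to ≤-antisym)
  open PosetReasoning ≤-poset

  x∧y≤x : x ∧ y ≤ x
  x∧y≤x {x} {y} = begin-equality
    (x ∧ y) ∧ x ≡⟨ ∧-assoc x y x ⟩
    x ∧ (y ∧ x) ≡⟨ cong (x ∧_) (∧-comm y x) ⟩
    x ∧ (x ∧ y) ≡⟨ sym (∧-assoc x x y) ⟩
    (x ∧ x) ∧ y ≡⟨ cong (_∧ y) (∧-idem x) ⟩
    x ∧ y       ∎

  x∧y≤y : x ∧ y ≤ y
  x∧y≤y {x} {y} = ≤-trans (≤-reflexive (∧-comm x y)) x∧y≤x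

  ∧-greatest : x ≤ y → x ≤ z → x ≤ y ∧ z
  ∧-greatest {x} {y} {z} x≤y x≤z = trans (sym (∧-assoc x y z)) (trans (cong (_∧ z) x≤y) x≤z)

  ·-commutativeSemigroup : CommutativeSemigroup a a
  ·-commutativeSemigroup = record
    { _≈_ = _≡_
    ; _∙_ = _·_
    ; isCommutativeSemigroup = record
      { isSemigroup = record
        { isMagma = record { isEquivalence = isEquivalence ; ∙-cong = cong₂ _·_ }
        ; assoc = ·-assoc
        }
      ; comm = ·-comm
      }
    }

  open CommutativeSemigroupProperties ·-commutativeSemigroup using (interchange; xy∙z≈xz∙y)

  ·-identityʳ : ∀ x → x · 𝟙 ≡ x
  ·-identityʳ x = trans (·-comm x 𝟙) (·-identityˡ x)

  ·≤⇒≤↝ : x · y ≤ z → x ≤ y ↝ z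
  ·≤⇒≤↝ = Equivalence.to (residuation _ _ _)

  ≤↝⇒·≤ : x ≤ y ↝ z → x · y ≤ z
  ≤↝⇒·≤ = Equivalence.from (residuation _ _ _)

  ↝-mp : (x ↝ y) · x ≤ y
  ↝-mp = ≤↝⇒·≤ ≤-refl

  ·-monoˡ-≤ : x ≤ y → x · z ≤ y · z
  ·-monoˡ-≤ x≤y = ≤↝⇒·≤ (≤-trans x≤y (·≤⇒≤↝ ≤-refl))

  ·-monoʳ-≤ : x ≤ y → z · x ≤ z · y
  ·-monoʳ-≤ {x} {y} {z} x≤y = begin
    z · x ≡⟨ ·-comm z x ⟩
    x · z ≤⟨ ·-monoˡ-≤ x≤y ⟩
    y · z ≡⟨ ·-comm y z ⟩
    z · y ∎

  ·-mono-≤ : x ≤ y → u ≤ v → x · u ≤ y · v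
  ·-mono-≤ x≤y u≤v = ≤-trans (·-monoˡ-≤ x≤y) (·-monoʳ-≤ u≤v)

  ≤⇒𝟙≤↝ : x ≤ y → 𝟙 ≤ x ↝ y
  ≤⇒𝟙≤↝ {x} x≤y = ·≤⇒≤↝ (≤-trans (≤-reflexive (·-identityˡ x)) x≤y)

  𝟙≤↝⇒≤ : 𝟙 ≤ x ↝ y → x ≤ y
  𝟙≤↝⇒≤ {x} 𝟙≤x↝y = ≤-trans (≤-reflexive (sym (·-identityˡ x))) (≤↝⇒·≤ 𝟙≤x↝y)

  x≤𝟙 : x ≤ 𝟙
  x≤𝟙 = integral _

  x·y≤x : x · y ≤ x
  x·y≤x {x} = ≤-trans (·-monoʳ-≤ x≤𝟙) (≤-reflexive (·-identityʳ x))

  ·≤-comm : u · v ≤ w → v · u ≤ w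
  ·≤-comm {u} {v} = ≤-trans (≤-reflexive (·-comm v u))

  x·y≤y : x · y ≤ y
  x·y≤y = ·≤-comm x·y≤x

  x·y≤x∧y : x · y ≤ x ∧ y
  x·y≤x∧y = ∧-greatest x·y≤x x·y≤y

  x·¬x≤𝟘 : x · ¬ x ≤ 𝟘
  x·¬x≤𝟘 = ·≤-comm ↝-mp

  x≤¬¬x : x ≤ ¬ ¬ x
  x≤¬¬x = ·≤⇒≤↝ x·¬x≤𝟘

  ¬-antitone : x ≤ y → ¬ y ≤ ¬ x
  ¬-antitone x≤y = ·≤⇒≤↝ (≤-trans (·-monoʳ-≤ x≤y) ↝-mp)

  𝟘≤¬x : 𝟘 ≤ ¬ x
  𝟘≤¬x = ·≤⇒≤↝ x·y≤x

  ·≤¬-swap : u · v ≤ ¬ w → u · w ≤ ¬ v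
  ·≤¬-swap {u} {v} {w} uv≤¬w = ·≤⇒≤↝ (begin
    (u · w) · v ≡⟨ xy∙z≈xz∙y u w v ⟩
    (u · v) · w ≤⟨ ≤↝⇒·≤ uv≤¬w ⟩
    𝟘           ∎)

  ·≤-contrapose : u · v ≤ w → ¬ w · v ≤ ¬ u
  ·≤-contrapose {u} {v} {w} uv≤w = ·≤⇒≤↝ (begin
    (¬ w · v) · u ≡⟨ ·-assoc (¬ w) v u ⟩
    ¬ w · (v · u) ≡⟨ cong (¬ w ·_) (·-comm v u) ⟩
    ¬ w · (u · v) ≤⟨ ·-monoʳ-≤ uv≤w ⟩
    ¬ w · w       ≤⟨ ↝-mp ⟩
    𝟘             ∎)

  module BoundedImplication (δ : Carrier → Carrier) (_⇛_ : Carrier → Carrier → Carrier)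
                            (bounded : Bounded A δ _⇛_) where

    ⇛-intro : u ≤ x ↝ y → v ≤ y ↝ δ x → u · v ≤ x ⇛ y
    ⇛-intro {x = x} {y} u≤x↝y v≤y↝δx = ≤-trans (·-mono-≤ u≤x↝y v≤y↝δx) (proj₁ (bounded x y))

    𝟙≤⇛ : x ≤ y → y ≤ δ x → 𝟙 ≤ x ⇛ y
    𝟙≤⇛ x≤y y≤δx =
      ≤-trans (≤-reflexive (sym (·-identityˡ 𝟙))) (⇛-intro (≤⇒𝟙≤↝ x≤y) (≤⇒𝟙≤↝ y≤δx))

    ·≤⇛ : x ≤ δ x → y · x ≤ x ⇛ y
    ·≤⇛ x≤δx = ⇛-intro (·≤⇒≤↝ x·y≤x) (·≤⇒≤↝ (≤-trans x·y≤x x≤δx))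

    ⇛≤↝ : x ⇛ y ≤ x ↝ y
    ⇛≤↝ {x} {y} = ≤-trans (proj₂ (bounded x y)) x∧y≤x

    ⇛≤↝δ : x ⇛ y ≤ y ↝ δ x
    ⇛≤↝δ {x} {y} = ≤-trans (proj₂ (bounded x y)) x∧y≤y

    ⇛-mp : (x ⇛ y) · x ≤ y
    ⇛-mp = ≤↝⇒·≤ ⇛≤↝

    ⇛·¬≤¬ : δ x ≤ ¬ ¬ x → (x ⇛ y) · ¬ x ≤ ¬ y
    ⇛·¬≤¬ δx≤¬¬x = ·≤¬-swap (≤-trans (≤↝⇒·≤ ⇛≤↝δ) δx≤¬¬x)

  module StronglyPseudoComplementedProperties (spc : StronglyPseudoComplemented A) where

    ¬[x↝y]≤¬¬x : ¬ (x ↝ y) ≤ ¬ ¬ x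
    ¬[x↝y]≤¬¬x {x} {y} = ·≤⇒≤↝ (begin
      ¬ (x ↝ y) · ¬ x ≤⟨ x·y≤x∧y ⟩
      ¬ (x ↝ y) ∧ ¬ x ≡⟨ ∧-comm (¬ (x ↝ y)) (¬ x) ⟩
      ¬ x ∧ ¬ (x ↝ y) ≤⟨ spc x y ⟩
      𝟘               ∎)

    x↝¬x≤¬x : x ↝ ¬ x ≤ ¬ x
    x↝¬x≤¬x {x} = ·≤⇒≤↝ (≤-trans (∧-greatest ↝-mp cx≤¬[x↝¬c]) (spc x (¬ c)))
      where
      c : Carrier
      c = x ↝ ¬ x
      cx≤¬[x↝¬c] : c · x ≤ ¬ (x ↝ ¬ c)
      cx≤¬[x↝¬c] = ·≤⇒≤↝ (begin
        (c · x) · (x ↝ ¬ c) ≡⟨ ·-assoc c x (x ↝ ¬ c) ⟩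
        c · (x · (x ↝ ¬ c)) ≡⟨ cong (c ·_) (·-comm x (x ↝ ¬ c)) ⟩
        c · ((x ↝ ¬ c) · x) ≤⟨ ·-monoʳ-≤ ↝-mp ⟩
        c · ¬ c             ≤⟨ x·¬x≤𝟘 ⟩
        𝟘                   ∎)

    ≤𝟘-by-cases : w · t ≤ ¬ t → w · ¬ t ≤ ¬ ¬ t → w ≤ 𝟘
    ≤𝟘-by-cases {t = t} wt≤¬t w¬t≤¬¬t =
      ≤-trans (∧-greatest (≤-trans (·≤⇒≤↝ wt≤¬t) x↝¬x≤¬x)
                          (≤-trans (·≤⇒≤↝ w¬t≤¬¬t) x↝¬x≤¬x))
              (spc t 𝟘)

    ·≤𝟘-by-cases : u · t ≤ p → v · t ≤ ¬ p → u · ¬ t ≤ q → v · ¬ t ≤ ¬ q → u · v ≤ 𝟘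
    ·≤𝟘-by-cases {u = u} {v = v} ut≤p vt≤¬p u¬t≤q v¬t≤¬q =
      ≤𝟘-by-cases (product≤¬ ut≤p vt≤¬p) (product≤¬ u¬t≤q v¬t≤¬q)
      where
      product≤¬ : ∀ {s r} → u · s ≤ r → v · s ≤ ¬ r → (u · v) · s ≤ ¬ s
      product≤¬ {s} {r} us≤r vs≤¬r = ·≤⇒≤↝ (begin
        ((u · v) · s) · s ≡⟨ ·-assoc (u · v) s s ⟩
        (u · v) · (s · s) ≡⟨ interchange u v s s ⟩
        (u · s) · (v · s) ≤⟨ ·-mono-≤ us≤r vs≤¬r ⟩
        r · ¬ r           ≤⟨ x·¬x≤𝟘 ⟩
        𝟘                 ∎)

    module _ (_⇛_ : Carrier → Carrier → Carrier) (bounded : Bounded A (λ x → ¬ ¬ x) _⇛_) where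
      open BoundedImplication (λ x → ¬ ¬ x) _⇛_ bounded hiding (⇛·¬≤¬)

      ⇛·¬≤¬ : (x ⇛ y) · ¬ x ≤ ¬ y
      ⇛·¬≤¬ = BoundedImplication.⇛·¬≤¬ (λ x → ¬ ¬ x) _⇛_ bounded ≤-refl

      ¬⇛·≤¬ : ¬ (x ⇛ y) · x ≤ ¬ y
      ¬⇛·≤¬ = ·≤-contrapose (·≤⇛ x≤¬¬x)

      ¬⇛·¬≤¬¬ : ¬ (x ⇛ y) · ¬ x ≤ ¬ ¬ y
      ¬⇛·¬≤¬¬ = ·≤¬-swap (≤-trans (·≤-contrapose ↝·¬≤⇛) ¬[x↝y]≤¬¬x)
        where
        ↝·¬≤⇛ : (x ↝ y) · ¬ y ≤ x ⇛ y
        ↝·¬≤⇛ = ⇛-intro ≤-refl (·≤⇒≤↝ (≤-trans ↝-mp 𝟘≤¬x))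

      ⇛·⇛¬≤𝟘 : (x ⇛ y) · (x ⇛ (¬ y)) ≤ 𝟘
      ⇛·⇛¬≤𝟘 = ·≤𝟘-by-cases ⇛-mp ⇛-mp ⇛·¬≤¬ ⇛·¬≤¬

      ¬⇛·¬⇛¬≤𝟘 : ¬ (x ⇛ y) · ¬ (x ⇛ (¬ y)) ≤ 𝟘
      ¬⇛·¬⇛¬≤𝟘 = ·≤𝟘-by-cases ¬⇛·≤¬ ¬⇛·≤¬ ¬⇛·¬≤¬¬ ¬⇛·¬≤¬¬

      𝟙≤⇛¬ : u · v ≤ 𝟘 → ¬ u · ¬ v ≤ 𝟘 → 𝟙 ≤ u ⇛ (¬ v)
      𝟙≤⇛¬ uv≤𝟘 ¬u¬v≤𝟘 = 𝟙≤⇛ (·≤⇒≤↝ uv≤𝟘) (·≤⇒≤↝ (·≤-comm ¬u¬v≤𝟘))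

      protoConnexive : ProtoConnexive A _⇛_
      protoConnexive =
          (λ x → ≤⇒𝟙≤↝ (≤𝟘-by-cases ⇛-mp ⇛·¬≤¬))
        , (λ x → ≤⇒𝟙≤↝ (≤𝟘-by-cases (≤-trans (·-monoʳ-≤ x≤¬¬x) ⇛·¬≤¬)
                                     (≤-trans ⇛-mp x≤¬¬x)))
        , (λ x y → 𝟙≤⇛¬ ⇛·⇛¬≤𝟘 ¬⇛·¬⇛¬≤𝟘)
        , (λ x y → 𝟙≤⇛¬ (·≤-comm ⇛·⇛¬≤𝟘) (·≤-comm ¬⇛·¬⇛¬≤𝟘))

  cond2⇒cond3 : Cond2 A → Cond3 A
  cond2⇒cond3 cond2 =
    (λ x → ¬ ¬ x) , _⇛_ , (λ x → x≤¬¬x) , bounded , proj₁ (proj₂ (proj₂ (cond2 _⇛_ bounded)))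
    where
    _⇛_ : Carrier → Carrier → Carrier
    x ⇛ y = (x ↝ y) ∧ (y ↝ ¬ ¬ x)
    bounded : Bounded A (λ x → ¬ ¬ x) _⇛_
    bounded x y = x·y≤x∧y , ≤-refl

  module Cond3⇒Cond1 (δ : Carrier → Carrier) (_⇛_ : Carrier → Carrier → Carrier)
                     (increasing : ∀ x → x ≤ δ x) (bounded : Bounded A δ _⇛_)
                     (connexive : ∀ x y → 𝟙 ≤ ((x ⇛ y) ⇛ (¬ (x ⇛ (¬ y))))) where
    open BoundedImplication δ _⇛_ bounded

    ⇛·⇛¬≤𝟘 : (x ⇛ y) · (x ⇛ (¬ y)) ≤ 𝟘
    ⇛·⇛¬≤𝟘 {x} {y} = ≤↝⇒·≤ (𝟙≤↝⇒≤ (≤-trans (connexive x y) ⇛≤↝))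

    ¬⇛¬≤δ⇛ : ¬ (x ⇛ (¬ y)) ≤ δ (x ⇛ y)
    ¬⇛¬≤δ⇛ {x} {y} = 𝟙≤↝⇒≤ (≤-trans (connexive x y) ⇛≤↝δ)

    𝟙⇛y≡y : 𝟙 ⇛ y ≡ y
    𝟙⇛y≡y {y} = ≤-antisym
      (≤-trans (≤-reflexive (sym (·-identityʳ (𝟙 ⇛ y)))) ⇛-mp)
      (≤-trans (≤-reflexive (sym (·-identityʳ y))) (·≤⇛ (increasing 𝟙)))

    ¬¬x≤δx : ¬ ¬ x ≤ δ x
    ¬¬x≤δx {x} = begin
      ¬ ¬ x            ≡⟨ cong ¬_ (sym 𝟙⇛y≡y) ⟩
      ¬ (𝟙 ⇛ (¬ x))    ≤⟨ ¬⇛¬≤δ⇛ ⟩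
      δ (𝟙 ⇛ x)        ≡⟨ cong δ 𝟙⇛y≡y ⟩
      δ x              ∎

    δx≤¬¬x : δ x ≤ ¬ ¬ x
    δx≤¬¬x {x} = ·≤⇒≤↝ (begin
      δ x · ¬ x                  ≡⟨ cong₂ _·_ (sym (·-identityˡ (δ x))) (sym (·-identityʳ (¬ x))) ⟩
      (𝟙 · δ x) · (¬ x · 𝟙)      ≤⟨ ·-mono-≤ (⇛-intro (≤⇒𝟙≤↝ x≤𝟙) (·≤⇒≤↝ x·y≤x))
                                             (⇛-intro (·≤⇒≤↝ (≤-trans ↝-mp 𝟘≤¬x)) (≤⇒𝟙≤↝ ¬𝟙≤δx)) ⟩
      (x ⇛ 𝟙) · (x ⇛ (¬ 𝟙))      ≤⟨ ⇛·⇛¬≤𝟘 ⟩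
      𝟘                          ∎)
      where
      ¬𝟙≤δx : ¬ 𝟙 ≤ δ x
      ¬𝟙≤δx = begin
        ¬ 𝟙       ≡⟨ sym (·-identityʳ (¬ 𝟙)) ⟩
        ¬ 𝟙 · 𝟙   ≤⟨ ↝-mp ⟩
        𝟘         ≤⟨ 𝟘≤¬x ⟩
        ¬ ¬ x     ≤⟨ ¬¬x≤δx ⟩
        δ x       ∎

    x↝¬x≤¬x : x ↝ ¬ x ≤ ¬ x
    x↝¬x≤¬x {x} = ·≤⇒≤↝ (begin
      (x ↝ ¬ x) · x             ≤⟨ ⇛-intro ≤-refl (·≤⇒≤↝ (≤-trans x·y≤x (increasing x))) ⟩
      x ⇛ (¬ x)                 ≡⟨ sym (·-identityˡ (x ⇛ (¬ x))) ⟩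
      𝟙 · (x ⇛ (¬ x))           ≤⟨ ·-monoˡ-≤ (𝟙≤⇛ ≤-refl (increasing x)) ⟩
      (x ⇛ x) · (x ⇛ (¬ x))     ≤⟨ ⇛·⇛¬≤𝟘 ⟩
      𝟘                         ∎)

    x·x≤𝟘⇒x≤𝟘 : x · x ≤ 𝟘 → x ≤ 𝟘
    x·x≤𝟘⇒x≤𝟘 {x} xx≤𝟘 = 𝟙≤↝⇒≤ (≤-trans (≤⇒𝟙≤↝ (·≤⇒≤↝ xx≤𝟘)) x↝¬x≤¬x)

    stronglyPseudoComplemented : StronglyPseudoComplemented A
    stronglyPseudoComplemented x y = x·x≤𝟘⇒x≤𝟘 (begin
      m · m       ≤⟨ ·-mono-≤ m≤¬c m≤¬d ⟩
      ¬ c · ¬ d   ≤⟨ ·≤-comm (≤↝⇒·≤ (≤-trans ¬⇛¬≤δ⇛ δx≤¬¬x)) ⟩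
      𝟘           ∎)
      where
      m c d : Carrier
      m = ¬ x ∧ ¬ (x ↝ y)
      c = x ⇛ y
      d = x ⇛ (¬ y)
      m≤¬y : m ≤ ¬ y
      m≤¬y = ≤-trans x∧y≤y (¬-antitone (·≤⇒≤↝ x·y≤x))
      m≤¬c : m ≤ ¬ c
      m≤¬c = ≤-trans x∧y≤y (¬-antitone ⇛≤↝)
      md≤¬¬y : m · d ≤ ¬ ¬ y
      md≤¬¬y = begin
        m · d     ≤⟨ ·-monoˡ-≤ x∧y≤x ⟩
        ¬ x · d   ≡⟨ ·-comm (¬ x) d ⟩
        d · ¬ x   ≤⟨ ⇛·¬≤¬ δx≤¬¬x ⟩
        ¬ ¬ y     ∎
      m≤¬d : m ≤ ¬ d
      m≤¬d = ·≤⇒≤↝ (x·x≤𝟘⇒x≤𝟘 (begin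
        (m · d) · (m · d) ≤⟨ ·-mono-≤ (≤-trans x·y≤x m≤¬y) md≤¬¬y ⟩
        ¬ y · ¬ ¬ y       ≤⟨ x·¬x≤𝟘 ⟩
        𝟘                 ∎))

theorem3p25 : ∀ {a : Level} (A : FLeAlgebra a) → Integral A →
    ((Cond1 A ⇔ Cond2 A) × (Cond2 A ⇔ Cond3 A))
theorem3p25 A integral =
  mk⇔ cond1⇒cond2 (cond3⇒cond1 ∘ cond2⇒cond3) , mk⇔ cond2⇒cond3 (cond1⇒cond2 ∘ cond3⇒cond1)
  where
  open IntegralFLe A integral
  cond1⇒cond2 : Cond1 A → Cond2 A
  cond1⇒cond2 spc = StronglyPseudoComplementedProperties.protoConnexive spc
  cond3⇒cond1 : Cond3 A → Cond1 A
  cond3⇒cond1 (δ , _⇛_ , increasing , bounded , connexive) =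
    Cond3⇒Cond1.stronglyPseudoComplemented δ _⇛_ increasing bounded connexive
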